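{- Let $\Sigma\subseteq\mathcal L$ be closed under subformulas and $\Gamma,\Delta\subseteq\Sigma$. If $\Gamma\not\vdash\Delta$, then there exists a $\Sigma$-type $\Phi$ such that $(\Phi,\Sigma\setminus\Phi)$ is consistent, $\Gamma\subseteq\Phi$ and $\Delta\subseteq\Sigma\setminus\Phi$.
   Context: Language $\mathcal L$ over a countably infinite set of variables: $\varphi ::= p\mid\varphi\wedge\psi\mid\varphi\vee\psi\mid\varphi\Rightarrow\psi\mid\varphi\Leftarrow\psi\mid\mathsf X\varphi\mid\mathsf Y\varphi\mid\mathsf G\varphi\mid\mathsf H\varphi\mid\varphi\,\mathsf U\,\psi\mid\varphi\,\mathsf S\,\psi$; $\top:=p\Rightarrow p$, $\bot:=p\Leftarrow p$ (fixed $p$), $\neg\varphi:=\varphi\Rightarrow\bot$, $\varphi\Leftrightarrow\psi:=(\varphi\Rightarrow\psi)\wedge(\psi\Rightarrow\varphi)$. $\mathsf{GTL}$ is the least set of $\mathcal L$-formulas containing: all substitution instances of intuitionistic propositional tautologies; $\varphi\Rightarrow(\psi\vee(\varphi\Leftarrow\psi))$; $(\varphi\Rightarrow\psi)\vee(\psi\Rightarrow\varphi)$; $\neg((\varphi\Leftarrow\psi)\wedge(\psi\Leftarrow\varphi))$; $\neg\mathsf X\bot$; $\mathsf X(\varphi\vee\psi)\Rightarrow(\mathsf X\varphi\vee\mathsf X\psi)$; $(\mathsf X\varphi\wedge\mathsf X\psi)\Rightarrow\mathsf X(\varphi\wedge\psi)$; $\mathsf X(\varphi\Rightarrow\psi)\Leftrightarrow(\mathsf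 X\varphi\Rightarrow\mathsf X\psi)$; $\mathsf G(\varphi\Rightarrow\psi)\Rightarrow(\mathsf G\varphi\Rightarrow\mathsf G\psi)$; $\mathsf G(\varphi\Rightarrow\psi)\Rightarrow(\theta\,\mathsf U\,\varphi\Rightarrow\theta\,\mathsf U\,\psi)$; $\mathsf G(\varphi\Rightarrow\psi)\Rightarrow(\varphi\,\mathsf U\,\theta\Rightarrow\psi\,\mathsf U\,\theta)$; $\mathsf G\varphi\Rightarrow\varphi\wedge\mathsf X\mathsf G\varphi$; $\psi\vee(\varphi\wedge\mathsf X(\varphi\,\mathsf U\,\psi))\Rightarrow\varphi\,\mathsf U\,\psi$; $\mathsf G(\varphi\Rightarrow\mathsf X\varphi)\Rightarrow(\varphi\Rightarrow\mathsf G\varphi)$; $\mathsf G(\psi\wedge\mathsf X\varphi\Rightarrow\varphi)\Rightarrow(\psi\,\mathsf U\,\varphi\Rightarrow\varphi)$; the same eleven temporal axioms with $\mathsf X,\mathsf G,\mathsf U$ replaced by $\mathsf Y,\mathsf H,\mathsf S$; $\varphi\Leftrightarrow\mathsf X\mathsf Y\varphi$; $\varphi\Leftrightarrow\mathsf Y\mathsf X\varphi$; and closed under: from $\varphi\Rightarrow\psi$ infer $(\varphi\Leftarrow\theta)\Rightarrow(\psi\Leftarrow\theta)$; from $\varphi\Rightarrow\psi\vee\gamma$ infer $(\varphi\Leftarrow\psi)\Rightarrow\gamma$; modus ponens; from $\varphi$ infer each of $\mathsf X\varphi,\mathsf Y\varphi,\mathsf G\varphi,\mathsf H\varphi$. For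 $\Gamma,\Delta\subseteq\mathcal L$, $\Gamma\vdash\Delta$ means there are finite (possibly empty) $\Gamma'\subseteq\Gamma$, $\Delta'\subseteq\Delta$ with $\bigwedge\Gamma'\Rightarrow\bigvee\Delta'\in\mathsf{GTL}$ (with $\bigwedge\varnothing=\top$, $\bigvee\varnothing=\bot$); $(\Gamma,\Delta)$ is consistent if $\Gamma\not\vdash\Delta$. For $\Sigma$ closed under subformulas, a $\Sigma$-type is $\Phi\subseteq\Sigma$ such that: if $\varphi\wedge\psi\in\Sigma$ then ($\varphi\wedge\psi\in\Phi$ iff $\varphi,\psi\in\Phi$); if $\varphi\vee\psi\in\Sigma$ then ($\varphi\vee\psi\in\Phi$ iff $\varphi\in\Phi$ or $\psi\in\Phi$); if $\varphi\Rightarrow\psi\in\Sigma$ then $\varphi\Rightarrow\psi\in\Phi$ implies ($\varphi\notin\Phi$ or $\psi\in\Phi$), and $\psi\in\Phi$ implies $\varphi\Rightarrow\psi\in\Phi$; if $\varphi\Leftarrow\psi\in\Sigma$ then $\varphi\Leftarrow\psi\in\Phi$ implies $\varphi\in\Phi$, and ($\varphi\in\Phi$ and $\psi\notin\Phi$) implies $\varphi\Leftarrow\psi\in\Phi$. -}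

module Defs where

open import Data.Nat using (ℕ)
open import Data.Product using (_×_; ∃; Σ-syntax)
open import Data.Sum using (_⊎_)
open import Data.List using (List; foldr)
open import Data.List.Relation.Unary.All using (All)
open import Relation.Nullary using (¬_)
open import Relation.Unary using (Pred; _∈_; _∉_; _⊆_)
open import Level using (0ℓ)

infixr 6 _∧_
infixr 5 _∨_
infixr 4 _⇒_ _⇐_ _⇔_

data Fml : Set where
  var    : ℕ → Fml
  _∧_    : Fml → Fml → Fml
  _∨_    : Fml → Fml → Fml
  _⇒_    : Fml → Fml → Fml
  _⇐_    : Fml → Fml → Fml
  𝐗 𝐘 𝐆 𝐇 : Fml → Fml
  _𝐔_    : Fml → Fml → Fml
  _𝐒_    : Fml → Fml → Fml

p₀ : Fml
p₀ = var 0

⊤ᶠ ⊥ᶠ : Fml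
⊤ᶠ = p₀ ⇒ p₀
⊥ᶠ = p₀ ⇐ p₀

¬ᶠ : Fml → Fml
¬ᶠ φ = φ ⇒ ⊥ᶠ

_⇔_ : Fml → Fml → Fml
φ ⇔ ψ = (φ ⇒ ψ) ∧ (ψ ⇒ φ)

-- Intuitionistic propositional logic (language: variables, ∧, ∨, →, ⊥, ⊤)
-- via a standard Hilbert system; its theorems are exactly the
-- intuitionistic propositional tautologies.

data PF : Set where
  pv   : ℕ → PF
  _p∧_ : PF → PF → PF
  _p∨_ : PF → PF → PF
  _p→_ : PF → PF → PF
  p⊥ p⊤ : PF

infixr 6 _p∧_
infixr 5 _p∨_
infixr 4 _p→_

data IPC : PF → Set where
  ax-K   : ∀ {a b} → IPC (a p→ b p→ a)
  ax-S   : ∀ {a b c} → IPC ((a p→ b p→ c) p→ (a p→ b) p→ a p→ c)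
  ax-∧i  : ∀ {a b} → IPC (a p→ b p→ (a p∧ b))
  ax-∧e₁ : ∀ {a b} → IPC ((a p∧ b) p→ a)
  ax-∧e₂ : ∀ {a b} → IPC ((a p∧ b) p→ b)
  ax-∨i₁ : ∀ {a b} → IPC (a p→ (a p∨ b))
  ax-∨i₂ : ∀ {a b} → IPC (b p→ (a p∨ b))
  ax-∨e  : ∀ {a b c} → IPC ((a p→ c) p→ (b p→ c) p→ (a p∨ b) p→ c)
  ax-efq : ∀ {a} → IPC (p⊥ p→ a)
  ax-⊤   : IPC p⊤
  ipc-mp : ∀ {a b} → IPC (a p→ b) → IPC a → IPC b

subst : (ℕ → Fml) → PF → Fml
subst σ (pv n)    = σ n
subst σ (a p∧ b)  = subst σ a ∧ subst σ b
subst σ (a p∨ b)  = subst σ a ∨ subst σ b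
subst σ (a p→ b)  = subst σ a ⇒ subst σ b
subst σ p⊥        = ⊥ᶠ
subst σ p⊤        = ⊤ᶠ

data GTL : Fml → Set where
  ipc      : ∀ σ {a} → IPC a → GTL (subst σ a)
  coimp    : ∀ {φ ψ} → GTL (φ ⇒ (ψ ∨ (φ ⇐ ψ)))
  lin      : ∀ {φ ψ} → GTL ((φ ⇒ ψ) ∨ (ψ ⇒ φ))
  co-lin   : ∀ {φ ψ} → GTL (¬ᶠ ((φ ⇐ ψ) ∧ (ψ ⇐ φ)))
  X-⊥      : GTL (¬ᶠ (𝐗 ⊥ᶠ))
  X-∨      : ∀ {φ ψ} → GTL (𝐗 (φ ∨ ψ) ⇒ (𝐗 φ ∨ 𝐗 ψ))
  X-∧      : ∀ {φ ψ} → GTL ((𝐗 φ ∧ 𝐗 ψ) ⇒ 𝐗 (φ ∧ ψ))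
  X-⇒      : ∀ {φ ψ} → GTL (𝐗 (φ ⇒ ψ) ⇔ (𝐗 φ ⇒ 𝐗 ψ))
  G-K      : ∀ {φ ψ} → GTL (𝐆 (φ ⇒ ψ) ⇒ (𝐆 φ ⇒ 𝐆 ψ))
  G-U₂     : ∀ {φ ψ θ} → GTL (𝐆 (φ ⇒ ψ) ⇒ ((θ 𝐔 φ) ⇒ (θ 𝐔 ψ)))
  G-U₁     : ∀ {φ ψ θ} → GTL (𝐆 (φ ⇒ ψ) ⇒ ((φ 𝐔 θ) ⇒ (ψ 𝐔 θ)))
  G-fix    : ∀ {φ} → GTL (𝐆 φ ⇒ (φ ∧ 𝐗 (𝐆 φ)))
  U-fix    : ∀ {φ ψ} → GTL ((ψ ∨ (φ ∧ 𝐗 (φ 𝐔 ψ))) ⇒ (φ 𝐔 ψ))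
  G-ind    : ∀ {φ} → GTL (𝐆 (φ ⇒ 𝐗 φ) ⇒ (φ ⇒ 𝐆 φ))
  U-ind    : ∀ {φ ψ} → GTL (𝐆 ((ψ ∧ 𝐗 φ) ⇒ φ) ⇒ ((ψ 𝐔 φ) ⇒ φ))
  Y-⊥      : GTL (¬ᶠ (𝐘 ⊥ᶠ))
  Y-∨      : ∀ {φ ψ} → GTL (𝐘 (φ ∨ ψ) ⇒ (𝐘 φ ∨ 𝐘 ψ))
  Y-∧      : ∀ {φ ψ} → GTL ((𝐘 φ ∧ 𝐘 ψ) ⇒ 𝐘 (φ ∧ ψ))
  Y-⇒      : ∀ {φ ψ} → GTL (𝐘 (φ ⇒ ψ) ⇔ (𝐘 φ ⇒ 𝐘 ψ))
  H-K      : ∀ {φ ψ} → GTL (𝐇 (φ ⇒ ψ) ⇒ (𝐇 φ ⇒ 𝐇 ψ))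
  H-S₂     : ∀ {φ ψ θ} → GTL (𝐇 (φ ⇒ ψ) ⇒ ((θ 𝐒 φ) ⇒ (θ 𝐒 ψ)))
  H-S₁     : ∀ {φ ψ θ} → GTL (𝐇 (φ ⇒ ψ) ⇒ ((φ 𝐒 θ) ⇒ (ψ 𝐒 θ)))
  H-fix    : ∀ {φ} → GTL (𝐇 φ ⇒ (φ ∧ 𝐘 (𝐇 φ)))
  S-fix    : ∀ {φ ψ} → GTL ((ψ ∨ (φ ∧ 𝐘 (φ 𝐒 ψ))) ⇒ (φ 𝐒 ψ))
  H-ind    : ∀ {φ} → GTL (𝐇 (φ ⇒ 𝐘 φ) ⇒ (φ ⇒ 𝐇 φ))
  S-ind    : ∀ {φ ψ} → GTL (𝐇 ((ψ ∧ 𝐘 φ) ⇒ φ) ⇒ ((ψ 𝐒 φ) ⇒ φ))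
  XY       : ∀ {φ} → GTL (φ ⇔ 𝐗 (𝐘 φ))
  YX       : ∀ {φ} → GTL (φ ⇔ 𝐘 (𝐗 φ))
  r-coimp-mono : ∀ {φ ψ θ} → GTL (φ ⇒ ψ) → GTL ((φ ⇐ θ) ⇒ (ψ ⇐ θ))
  r-coimp-res  : ∀ {φ ψ γ} → GTL (φ ⇒ (ψ ∨ γ)) → GTL ((φ ⇐ ψ) ⇒ γ)
  mp           : ∀ {φ ψ} → GTL (φ ⇒ ψ) → GTL φ → GTL ψ
  nec-X        : ∀ {φ} → GTL φ → GTL (𝐗 φ)
  nec-Y        : ∀ {φ} → GTL φ → GTL (𝐘 φ)
  nec-G        : ∀ {φ} → GTL φ → GTL (𝐆 φ)
  nec-H        : ∀ {φ} → GTL φ → GTL (𝐇 φ)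

⋀ : List Fml → Fml
⋀ = foldr _∧_ ⊤ᶠ

⋁ : List Fml → Fml
⋁ = foldr _∨_ ⊥ᶠ

_⊢_ : Pred Fml 0ℓ → Pred Fml 0ℓ → Set
Γ ⊢ Δ = Σ[ Γ' ∈ List Fml ] Σ[ Δ' ∈ List Fml ]
          (All (_∈ Γ) Γ' × All (_∈ Δ) Δ' × GTL (⋀ Γ' ⇒ ⋁ Δ'))

Consistent : Pred Fml 0ℓ → Pred Fml 0ℓ → Set
Consistent Γ Δ = ¬ (Γ ⊢ Δ)

_∖_ : Pred Fml 0ℓ → Pred Fml 0ℓ → Pred Fml 0ℓ
(A ∖ B) φ = φ ∈ A × φ ∉ B

record SubformulaClosed (Sig : Pred Fml 0ℓ) : Set where
  field
    ∧ₗ : ∀ {φ ψ} → (φ ∧ ψ) ∈ Sig → φ ∈ Sig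
    ∧ᵣ : ∀ {φ ψ} → (φ ∧ ψ) ∈ Sig → ψ ∈ Sig
    ∨ₗ : ∀ {φ ψ} → (φ ∨ ψ) ∈ Sig → φ ∈ Sig
    ∨ᵣ : ∀ {φ ψ} → (φ ∨ ψ) ∈ Sig → ψ ∈ Sig
    ⇒ₗ : ∀ {φ ψ} → (φ ⇒ ψ) ∈ Sig → φ ∈ Sig
    ⇒ᵣ : ∀ {φ ψ} → (φ ⇒ ψ) ∈ Sig → ψ ∈ Sig
    ⇐ₗ : ∀ {φ ψ} → (φ ⇐ ψ) ∈ Sig → φ ∈ Sig
    ⇐ᵣ : ∀ {φ ψ} → (φ ⇐ ψ) ∈ Sig → ψ ∈ Sig
    Uₗ : ∀ {φ ψ} → (φ 𝐔 ψ) ∈ Sig → φ ∈ Sig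
    Uᵣ : ∀ {φ ψ} → (φ 𝐔 ψ) ∈ Sig → ψ ∈ Sig
    Sₗ : ∀ {φ ψ} → (φ 𝐒 ψ) ∈ Sig → φ ∈ Sig
    Sᵣ : ∀ {φ ψ} → (φ 𝐒 ψ) ∈ Sig → ψ ∈ Sig
    X↓ : ∀ {φ} → 𝐗 φ ∈ Sig → φ ∈ Sig
    Y↓ : ∀ {φ} → 𝐘 φ ∈ Sig → φ ∈ Sig
    G↓ : ∀ {φ} → 𝐆 φ ∈ Sig → φ ∈ Sig
    H↓ : ∀ {φ} → 𝐇 φ ∈ Sig → φ ∈ Sig

record IsType (Sig Φ : Pred Fml 0ℓ) : Set where
  field
    ⊆Sig : Φ ⊆ Sig
    ∧-in  : ∀ {φ ψ} → (φ ∧ ψ) ∈ Sig → (φ ∧ ψ) ∈ Φ → φ ∈ Φ × ψ ∈ Φ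
    ∧-out : ∀ {φ ψ} → (φ ∧ ψ) ∈ Sig → φ ∈ Φ × ψ ∈ Φ → (φ ∧ ψ) ∈ Φ
    ∨-in  : ∀ {φ ψ} → (φ ∨ ψ) ∈ Sig → (φ ∨ ψ) ∈ Φ → φ ∈ Φ ⊎ ψ ∈ Φ
    ∨-out : ∀ {φ ψ} → (φ ∨ ψ) ∈ Sig → φ ∈ Φ ⊎ ψ ∈ Φ → (φ ∨ ψ) ∈ Φ
    ⇒-in  : ∀ {φ ψ} → (φ ⇒ ψ) ∈ Sig → (φ ⇒ ψ) ∈ Φ → φ ∉ Φ ⊎ ψ ∈ Φ
    ⇒-out : ∀ {φ ψ} → (φ ⇒ ψ) ∈ Sig → ψ ∈ Φ → (φ ⇒ ψ) ∈ Φ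
    ⇐-in  : ∀ {φ ψ} → (φ ⇐ ψ) ∈ Sig → (φ ⇐ ψ) ∈ Φ → φ ∈ Φ
    ⇐-out : ∀ {φ ψ} → (φ ⇐ ψ) ∈ Sig → φ ∈ Φ → ψ ∉ Φ → (φ ⇐ ψ) ∈ Φ

-- Lindenbaum's construction: enumerate all formulas and put each one on the left
-- if that keeps the pair consistent, otherwise on the right (cut guarantees that
-- one of the two choices is consistent).  The union of the stages is a consistent
-- pair (Φ, Ψ) covering every formula.  Restricted to Σ, Φ is consistent against
-- Σ ∖ Φ, so (classically) whenever formulas of Φ derive a disjunction of formulas
-- of Σ, one of the disjuncts lies in Φ; every clause of a Σ-type is an instance.
module Submission where

open import Defs
open import Level using (0ℓ)
open import Function using (_∘_; _$_; id)
open import Data.Empty using (⊥-elim)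
open import Data.Nat using (ℕ; zero; suc; _≤_; _⊔_; _≤′_; ≤′-reflexive; ≤′-step)
open import Data.Nat.Properties using (≤⇒≤′; m≤m⊔n; m≤n⊔m)
open import Data.Product using (_×_; ∃; ∃₂; _,_; proj₁; proj₂)
open import Data.Sum using (_⊎_; inj₁; inj₂; [_,_]′)
open import Data.List using (List; []; _∷_; _++_; foldl; cartesianProductWith)
import Data.List.Relation.Unary.All as All
open import Data.List.Relation.Unary.All using (All; []; _∷_)
open import Data.List.Relation.Unary.All.Properties using (++⁺; ¬Any⇒All¬)
open import Data.List.Relation.Unary.Any using (Any; here; there; any?)
open import Data.List.Membership.Propositional using () renaming (_∈_ to _∈ˡ_)
open import Data.List.Membership.Propositional.Properties
  using (∈-++⁺ˡ; ∈-++⁺ʳ; ∈-cartesianProductWith⁺)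
open import Data.List.Relation.Binary.Subset.Propositional using () renaming (_⊆_ to _⊆ˡ_)
open import Data.List.Relation.Binary.Subset.Propositional.Properties
  using (⊆-trans; xs⊆x∷xs; ∷⁺ʳ; ∈-∷⁺ʳ; xs⊆xs++ys; xs⊆ys++xs)
open import Relation.Nullary using (Dec; yes; no)
open import Relation.Binary.PropositionalEquality using (refl; sym)
open import Relation.Unary using (Pred; _∈_; _∉_; _⊆_; _∪_; _∩_; ｛_｝; ⋃)
open import Axiom.ExcludedMiddle using (ExcludedMiddle)

private
  variable
    a b c φ ψ : Fml
    hs ks ns : List Fml
    Γ Γ′ Δ Δ′ : Pred Fml 0ℓ

inst₃ : Fml → Fml → Fml → ℕ → Fml
inst₃ a b c zero          = a
inst₃ a b c (suc zero)    = b
inst₃ a b c (suc (suc _)) = c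

K : GTL (a ⇒ b ⇒ a)
K {a} {b} = ipc (inst₃ a b a) (ax-K {pv 0} {pv 1})

S : GTL ((a ⇒ b ⇒ c) ⇒ (a ⇒ b) ⇒ a ⇒ c)
S {a} {b} {c} = ipc (inst₃ a b c) (ax-S {pv 0} {pv 1} {pv 2})

I : GTL (a ⇒ a)
I {a} = mp (mp (S {a} {a ⇒ a} {a}) K) (K {a} {a})

coimp-elim : GTL ((a ⇐ b) ⇒ a)
coimp-elim {a} {b} = r-coimp-res (ipc (inst₃ b a a) (ax-∨i₂ {pv 0} {pv 1}))

infix 3 _⊩_

data _⊩_ (hs : List Fml) : Fml → Set where
  hyp : φ ∈ˡ hs → hs ⊩ φ
  thm : GTL φ → hs ⊩ φ
  app : hs ⊩ φ ⇒ ψ → hs ⊩ φ → hs ⊩ ψ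

h₀ : φ ∷ hs ⊩ φ
h₀ = hyp (here refl)

h₁ : φ ∷ ψ ∷ hs ⊩ ψ
h₁ = hyp (there (here refl))

deduction : φ ∷ hs ⊩ ψ → hs ⊩ φ ⇒ ψ
deduction (hyp (here refl)) = thm I
deduction (hyp (there p))   = app (thm K) (hyp p)
deduction (thm g)           = app (thm K) (thm g)
deduction (app d e)         = app (app (thm S) (deduction d)) (deduction e)

⊩-closed : [] ⊩ φ → GTL φ
⊩-closed (thm g)   = g
⊩-closed (app d e) = mp (⊩-closed d) (⊩-closed e)

⊩-subst : (∀ {x} → x ∈ˡ hs → ks ⊩ x) → hs ⊩ φ → ks ⊩ φ
⊩-subst σ (hyp p)   = σ p
⊩-subst σ (thm g)   = thm g
⊩-subst σ (app d e) = app (⊩-subst σ d) (⊩-subst σ e)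

⊩-weaken : hs ⊆ˡ ks → hs ⊩ φ → ks ⊩ φ
⊩-weaken sub = ⊩-subst (hyp ∘ sub)

∧I : hs ⊩ a → hs ⊩ b → hs ⊩ a ∧ b
∧I {a = a} {b} d e = app (app (thm (ipc (inst₃ a b a) (ax-∧i {pv 0} {pv 1}))) d) e

∧E₁ : hs ⊩ a ∧ b → hs ⊩ a
∧E₁ {a = a} {b} = app (thm (ipc (inst₃ a b a) (ax-∧e₁ {pv 0} {pv 1})))

∧E₂ : hs ⊩ a ∧ b → hs ⊩ b
∧E₂ {a = a} {b} = app (thm (ipc (inst₃ a b a) (ax-∧e₂ {pv 0} {pv 1})))

∨I₁ : hs ⊩ a → hs ⊩ a ∨ b
∨I₁ {a = a} {b} = app (thm (ipc (inst₃ a b a) (ax-∨i₁ {pv 0} {pv 1})))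

∨I₂ : hs ⊩ b → hs ⊩ a ∨ b
∨I₂ {b = b} {a = a} = app (thm (ipc (inst₃ a b a) (ax-∨i₂ {pv 0} {pv 1})))

∨E : hs ⊩ a ∨ b → hs ⊩ a ⇒ c → hs ⊩ b ⇒ c → hs ⊩ c
∨E {a = a} {b} {c} d l r =
  app (app (app (thm (ipc (inst₃ a b c) (ax-∨e {pv 0} {pv 1} {pv 2}))) l) r) d

⊥E : hs ⊩ ⊥ᶠ → hs ⊩ c
⊥E {c = c} = app (thm (ipc (inst₃ c c c) (ax-efq {pv 0})))

⋀-intro : ∀ ns → (∀ {x} → x ∈ˡ ns → hs ⊩ x) → hs ⊩ ⋀ ns
⋀-intro []       _ = thm I
⋀-intro (x ∷ ns) f = ∧I (f (here refl)) (⋀-intro ns (f ∘ there))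

⋀-elim : hs ⊩ ⋀ ns → ∀ {x} → x ∈ˡ ns → hs ⊩ x
⋀-elim d (here refl) = ∧E₁ d
⋀-elim d (there p)   = ⋀-elim (∧E₂ d) p

⋁-intro : φ ∈ˡ ns → hs ⊩ φ → hs ⊩ ⋁ ns
⋁-intro (here refl) = ∨I₁
⋁-intro (there p)   = ∨I₂ ∘ ⋁-intro p

⋁-elim : ∀ ns → hs ⊩ ⋁ ns → (∀ {x} → x ∈ˡ ns → hs ⊩ x ⇒ c) → hs ⊩ c
⋁-elim []       d _ = ⊥E d
⋁-elim (x ∷ ns) d f =
  ∨E d (f (here refl)) (deduction (⋁-elim ns h₀ (⊩-weaken there ∘ f ∘ there)))

⋁-mono : ns ⊆ˡ ks → hs ⊩ ⋁ ns → hs ⊩ ⋁ ks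
⋁-mono {ns} sub d = ⋁-elim ns d (λ p → deduction (⋁-intro (sub p) h₀))

⊩⇒GTL : hs ⊩ φ → GTL (⋀ hs ⇒ φ)
⊩⇒GTL d = ⊩-closed (deduction (⊩-subst (⋀-elim h₀) d))

GTL⇒⊩ : GTL (⋀ hs ⇒ φ) → hs ⊩ φ
GTL⇒⊩ {hs} g = app (thm g) (⋀-intro hs hyp)

⊢-intro : All (_∈ Γ) hs → All (_∈ Δ) ns → hs ⊩ ⋁ ns → Γ ⊢ Δ
⊢-intro {hs = hs} {ns = ns} γ δ d = hs , ns , γ , δ , ⊩⇒GTL d

⊢-mono : Γ ⊆ Γ′ → Δ ⊆ Δ′ → Γ ⊢ Δ → Γ′ ⊢ Δ′
⊢-mono Γ⊆ Δ⊆ (hs , ns , γ , δ , g) = hs , ns , All.map Γ⊆ γ , All.map Δ⊆ δ , g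

Consistent-antitone : Γ ⊆ Γ′ → Δ ⊆ Δ′ → Consistent Γ′ Δ′ → Consistent Γ Δ
Consistent-antitone Γ⊆ Δ⊆ con = con ∘ ⊢-mono Γ⊆ Δ⊆

shared⇒⊢ : φ ∈ Γ → φ ∈ Δ → Γ ⊢ Δ
shared⇒⊢ φ∈Γ φ∈Δ = ⊢-intro (φ∈Γ ∷ []) (φ∈Δ ∷ []) (∨I₁ h₀)

strip : ∀ hs → All (_∈ Γ ∪ ｛ φ ｝) hs → ∃ λ hs′ → All (_∈ Γ) hs′ × hs ⊆ˡ φ ∷ hs′
strip []       []                = [] , [] , λ ()
strip (x ∷ hs) (inj₁ x∈Γ ∷ ps) with strip hs ps
... | hs′ , ps′ , sub =
  x ∷ hs′ , x∈Γ ∷ ps′ ,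
  ∈-∷⁺ʳ (there (here refl)) (⊆-trans sub (∷⁺ʳ _ (xs⊆x∷xs hs′ x)))
strip (x ∷ hs) (inj₂ φ≡x ∷ ps) with strip hs ps
... | hs′ , ps′ , sub = hs′ , ps′ , ∈-∷⁺ʳ (here (sym φ≡x)) sub

cut : Γ ⊢ (Δ ∪ ｛ φ ｝) → (Γ ∪ ｛ φ ｝) ⊢ Δ → Γ ⊢ Δ
cut {φ = φ} (hs₁ , ns₁ , γ₁ , δ₁ , g₁) (hs₂ , ns₂ , γ₂ , δ₂ , g₂)
  with strip ns₁ δ₁ | strip hs₂ γ₂
... | ns₁′ , δ₁′ , ns₁⊆ | hs₂′ , γ₂′ , hs₂⊆ =
  ⊢-intro (++⁺ γ₁ γ₂′) (++⁺ δ₁′ δ₂)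
    (∨E left (deduction (⋁-mono (xs⊆ys++xs ns₂ ns₁′) right))
             (deduction (⋁-mono (xs⊆xs++ys ns₁′ ns₂) h₀)))
  where
  left : hs₁ ++ hs₂′ ⊩ φ ∨ ⋁ ns₁′
  left = ⊩-weaken (xs⊆xs++ys hs₁ hs₂′) (⋁-mono ns₁⊆ (GTL⇒⊩ g₁))
  right : φ ∷ hs₁ ++ hs₂′ ⊩ ⋁ ns₂
  right = ⊩-weaken (⊆-trans hs₂⊆ (∷⁺ʳ φ (xs⊆ys++xs hs₂′ hs₁))) (GTL⇒⊩ g₂)

infixl 6 _⊛_

_⊛_ : {A B : Set} → List (A → B) → List A → List B
fs ⊛ xs = cartesianProductWith _$_ fs xs

unaryOps : List (Fml → Fml)
unaryOps = 𝐗 ∷ 𝐘 ∷ 𝐆 ∷ 𝐇 ∷ []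

binaryOps : List (Fml → Fml → Fml)
binaryOps = _∧_ ∷ _∨_ ∷ _⇒_ ∷ _⇐_ ∷ _𝐔_ ∷ _𝐒_ ∷ []

formulas : ℕ → List Fml
formulas zero    = []
formulas (suc k) =
  formulas k ++ var k ∷ unaryOps ⊛ formulas k ++ binaryOps ⊛ formulas k ⊛ formulas k

Increasing : (ℕ → Pred Fml 0ℓ) → Set
Increasing P = ∀ n → P n ⊆ P (suc n)

Increasing⇒monotone : ∀ {P} → Increasing P → ∀ {m n} → m ≤ n → P m ⊆ P n
Increasing⇒monotone {P} inc = go ∘ ≤⇒≤′
  where
  go : ∀ {m n} → m ≤′ n → P m ⊆ P n
  go (≤′-reflexive refl) = id
  go (≤′-step q)         = inc _ ∘ go q

formulas-increasing : Increasing (λ k φ → φ ∈ˡ formulas k)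
formulas-increasing _ = ∈-++⁺ˡ

Enumerated : Pred Fml 0ℓ
Enumerated φ = ∃ λ k → φ ∈ˡ formulas k

unary-enumerated : ∀ {f} → f ∈ˡ unaryOps → Enumerated φ → Enumerated (f φ)
unary-enumerated f∈ (k , φ∈) =
  suc k , ∈-++⁺ʳ (formulas k) (there (∈-++⁺ˡ (∈-cartesianProductWith⁺ _$_ f∈ φ∈)))

binary-enumerated : ∀ {f} → f ∈ˡ binaryOps → Enumerated φ → Enumerated ψ → Enumerated (f φ ψ)
binary-enumerated f∈ (k , φ∈) (m , ψ∈) =
  suc (k ⊔ m) , ∈-++⁺ʳ (formulas (k ⊔ m)) (there (∈-++⁺ʳ (unaryOps ⊛ formulas (k ⊔ m)) fφψ∈))
  where
  lift = Increasing⇒monotone formulas-increasing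
  fφψ∈ = ∈-cartesianProductWith⁺ _$_
           (∈-cartesianProductWith⁺ _$_ f∈ (lift (m≤m⊔n k m) φ∈)) (lift (m≤n⊔m k m) ψ∈)

enumerated : ∀ φ → Enumerated φ
enumerated (var n) = suc n , ∈-++⁺ʳ (formulas n) (here refl)
enumerated (𝐗 φ)   = unary-enumerated (here refl) (enumerated φ)
enumerated (𝐘 φ)   = unary-enumerated (there (here refl)) (enumerated φ)
enumerated (𝐆 φ)   = unary-enumerated (there (there (here refl))) (enumerated φ)
enumerated (𝐇 φ)   = unary-enumerated (there (there (there (here refl)))) (enumerated φ)
enumerated (φ ∧ ψ) = binary-enumerated (here refl) (enumerated φ) (enumerated ψ)
enumerated (φ ∨ ψ) = binary-enumerated (there (here refl)) (enumerated φ) (enumerated ψ)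
enumerated (φ ⇒ ψ) = binary-enumerated (there (there (here refl))) (enumerated φ) (enumerated ψ)
enumerated (φ ⇐ ψ) =
  binary-enumerated (there (there (there (here refl)))) (enumerated φ) (enumerated ψ)
enumerated (φ 𝐔 ψ) =
  binary-enumerated (there (there (there (there (here refl))))) (enumerated φ) (enumerated ψ)
enumerated (φ 𝐒 ψ) =
  binary-enumerated (there (there (there (there (there (here refl)))))) (enumerated φ) (enumerated ψ)

⋃-finite : ∀ {P} → Increasing P → All (_∈ ⋃ ℕ P) hs → ∃ λ n → All (_∈ P n) hs
⋃-finite inc []              = 0 , []
⋃-finite inc ((k , x∈) ∷ ps) with ⋃-finite inc ps
... | n , ps′ = k ⊔ n , lift (m≤m⊔n k n) x∈ ∷ All.map (lift (m≤n⊔m k n)) ps′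
  where lift = Increasing⇒monotone inc

⋃-consistent : ∀ {A B} → Increasing A → Increasing B →
  (∀ n → Consistent (A n) (B n)) → Consistent (⋃ ℕ A) (⋃ ℕ B)
⋃-consistent incA incB con (hs , ns , γ , δ , g) with ⋃-finite incA γ | ⋃-finite incB δ
... | n , γ′ | m , δ′ =
  con (n ⊔ m) (hs , ns , All.map (Increasing⇒monotone incA (m≤m⊔n n m)) γ′
                       , All.map (Increasing⇒monotone incB (m≤n⊔m n m)) δ′ , g)

module Lindenbaum (lem : ExcludedMiddle 0ℓ) where

  Pair : Set₁
  Pair = Pred Fml 0ℓ × Pred Fml 0ℓ

  ConsistentPair : Pair → Set
  ConsistentPair (Γ , Δ) = Consistent Γ Δ

  _⊑_ : Pair → Pair → Set
  (Γ , Δ) ⊑ (Γ′ , Δ′) = Γ ⊆ Γ′ × Δ ⊆ Δ′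

  ⊑-trans : ∀ {s t u} → s ⊑ t → t ⊑ u → s ⊑ u
  ⊑-trans (Γ⊆ , Δ⊆) (Γ⊆′ , Δ⊆′) = Γ⊆′ ∘ Γ⊆ , Δ⊆′ ∘ Δ⊆

  Decides : Fml → Pair → Set
  Decides φ (Γ , Δ) = φ ∈ Γ ⊎ φ ∈ Δ

  ⊑-decides : ∀ {s t} → s ⊑ t → Decides φ s → Decides φ t
  ⊑-decides (Γ⊆ , Δ⊆) = [ inj₁ ∘ Γ⊆ , inj₂ ∘ Δ⊆ ]′

  place : ∀ Γ Δ φ → Dec (Consistent (Γ ∪ ｛ φ ｝) Δ) → Pair
  place Γ Δ φ (yes _) = Γ ∪ ｛ φ ｝ , Δ
  place Γ Δ φ (no _)  = Γ , Δ ∪ ｛ φ ｝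

  place-⊑ : ∀ d → (Γ , Δ) ⊑ place Γ Δ φ d
  place-⊑ (yes _) = inj₁ , id
  place-⊑ (no _)  = id , inj₁

  place-consistent : ∀ d → Consistent Γ Δ → ConsistentPair (place Γ Δ φ d)
  place-consistent (yes con′) con = con′
  place-consistent (no ¬con′) con = λ ⊢φ → ¬con′ (λ φ⊢ → con (cut ⊢φ φ⊢))

  place-decides : ∀ d → Decides φ (place Γ Δ φ d)
  place-decides (yes _) = inj₁ (inj₂ refl)
  place-decides (no _)  = inj₂ (inj₂ refl)

  step : Pair → Fml → Pair
  step (Γ , Δ) φ = place Γ Δ φ lem

  extend : Pair → List Fml → Pair
  extend = foldl step

  extend-⊑ : ∀ s l → s ⊑ extend s l
  extend-⊑ s       []      = id , id
  extend-⊑ (Γ , Δ) (φ ∷ l) =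
    ⊑-trans {Γ , Δ} (place-⊑ lem) (extend-⊑ (place Γ Δ φ lem) l)

  extend-consistent : ∀ s l → ConsistentPair s → ConsistentPair (extend s l)
  extend-consistent s       []      con = con
  extend-consistent (Γ , Δ) (φ ∷ l) con = extend-consistent _ l (place-consistent lem con)

  extend-decides : ∀ s l → φ ∈ˡ l → Decides φ (extend s l)
  extend-decides (Γ , Δ) (φ ∷ l) (here refl) =
    ⊑-decides {s = place Γ Δ φ lem} (extend-⊑ _ l) (place-decides lem)
  extend-decides (Γ , Δ) (ψ ∷ l) (there p) = extend-decides (place Γ Δ ψ lem) l p

  stage : Pair → ℕ → Pair
  stage s zero    = s
  stage s (suc k) = extend (stage s k) (formulas k)

  lindenbaum : Consistent Γ Δ →
    ∃₂ λ (Φ Ψ : Pred Fml 0ℓ) →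
      Γ ⊆ Φ × Δ ⊆ Ψ × Consistent Φ Ψ × (∀ φ → φ ∈ Φ ⊎ φ ∈ Ψ)
  lindenbaum {Γ} {Δ} con =
    ⋃ ℕ Φₙ , ⋃ ℕ Ψₙ , (0 ,_) , (0 ,_) ,
    ⋃-consistent (proj₁ ∘ stage-⊑) (proj₂ ∘ stage-⊑) stage-consistent , decided
    where
    Φₙ Ψₙ : ℕ → Pred Fml 0ℓ
    Φₙ = proj₁ ∘ stage (Γ , Δ)
    Ψₙ = proj₂ ∘ stage (Γ , Δ)
    stage-⊑ : ∀ k → stage (Γ , Δ) k ⊑ stage (Γ , Δ) (suc k)
    stage-⊑ k = extend-⊑ (stage (Γ , Δ) k) (formulas k)
    stage-consistent : ∀ k → Consistent (Φₙ k) (Ψₙ k)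
    stage-consistent zero    = con
    stage-consistent (suc k) = extend-consistent _ (formulas k) (stage-consistent k)
    decided : ∀ φ → φ ∈ ⋃ ℕ Φₙ ⊎ φ ∈ ⋃ ℕ Ψₙ
    decided φ with enumerated φ
    ... | k , φ∈ = [ inj₁ ∘ (suc k ,_) , inj₂ ∘ (suc k ,_) ]′
                     (extend-decides (stage (Γ , Δ) k) (formulas k) φ∈)

module _ (lem : ExcludedMiddle 0ℓ) {Sig Φ : Pred Fml 0ℓ} (con : Consistent Φ (Sig ∖ Φ)) where

  derivable⇒Any∈ : All (_∈ Φ) hs → All (_∈ Sig) ns → hs ⊩ ⋁ ns → Any (_∈ Φ) ns
  derivable⇒Any∈ {ns = ns} γ σ d with any? (λ _ → lem) ns
  ... | yes found = found
  ... | no none   = ⊥-elim (con (⊢-intro γ (All.zip (σ , ¬Any⇒All¬ ns none)) d))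

  derivable⇒∈ : All (_∈ Φ) hs → φ ∈ Sig → hs ⊩ φ → φ ∈ Φ
  derivable⇒∈ γ φ∈Sig d with derivable⇒Any∈ γ (φ∈Sig ∷ []) (∨I₁ d)
  ... | here φ∈Φ = φ∈Φ

  derivable-∨⇒∈ : All (_∈ Φ) hs → φ ∈ Sig → ψ ∈ Sig → hs ⊩ φ ∨ ψ → φ ∈ Φ ⊎ ψ ∈ Φ
  derivable-∨⇒∈ γ φ∈Sig ψ∈Sig d
    with derivable⇒Any∈ γ (φ∈Sig ∷ ψ∈Sig ∷ [])
           (∨E d (deduction (∨I₁ h₀)) (deduction (∨I₂ (∨I₁ h₀))))
  ... | here φ∈Φ          = inj₁ φ∈Φ
  ... | there (here ψ∈Φ) = inj₂ ψ∈Φ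

  consistent-complement⇒IsType : SubformulaClosed Sig → Φ ⊆ Sig → IsType Sig Φ
  consistent-complement⇒IsType sc Φ⊆Sig = record
    { ⊆Sig  = Φ⊆Sig
    ; ∧-in  = λ S p →
        derivable⇒∈ (p ∷ []) (∧ₗ S) (∧E₁ h₀) , derivable⇒∈ (p ∷ []) (∧ᵣ S) (∧E₂ h₀)
    ; ∧-out = λ S (p , q) → derivable⇒∈ (p ∷ q ∷ []) S (∧I h₀ h₁)
    ; ∨-in  = λ S p → derivable-∨⇒∈ (p ∷ []) (∨ₗ S) (∨ᵣ S) h₀
    ; ∨-out = λ S → [ (λ p → derivable⇒∈ (p ∷ []) S (∨I₁ h₀))
                    , (λ q → derivable⇒∈ (q ∷ []) S (∨I₂ h₀)) ]′
    ; ⇒-in  = ⇒-in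
    ; ⇒-out = λ S q → derivable⇒∈ (q ∷ []) S (deduction h₁)
    ; ⇐-in  = λ S p → derivable⇒∈ (p ∷ []) (⇐ₗ S) (app (thm coimp-elim) h₀)
    ; ⇐-out = λ S p ψ∉Φ →
        [ ⊥-elim ∘ ψ∉Φ , id ]′ (derivable-∨⇒∈ (p ∷ []) (⇐ᵣ S) S (app (thm coimp) h₀))
    }
    where
    open SubformulaClosed sc
    ⇒-in : (φ ⇒ ψ) ∈ Sig → (φ ⇒ ψ) ∈ Φ → φ ∉ Φ ⊎ ψ ∈ Φ
    ⇒-in {φ} S p with lem {φ ∈ Φ}
    ... | no φ∉Φ = inj₁ φ∉Φ
    ... | yes φ∈Φ = inj₂ (derivable⇒∈ (p ∷ φ∈Φ ∷ []) (⇒ᵣ S) (app h₀ h₁))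

lemma8p3 : ExcludedMiddle 0ℓ →
    (Sig Γ Δ : Pred Fml 0ℓ) → SubformulaClosed Sig → Γ ⊆ Sig → Δ ⊆ Sig →
    Consistent Γ Δ →
    ∃ λ (Φ : Pred Fml 0ℓ) → IsType Sig Φ × Consistent Φ (Sig ∖ Φ) × Γ ⊆ Φ × Δ ⊆ (Sig ∖ Φ)
lemma8p3 lem Sig Γ Δ sc Γ⊆Sig Δ⊆Sig con with Lindenbaum.lindenbaum lem con
... | Φ , Ψ , Γ⊆Φ , Δ⊆Ψ , conΦΨ , total =
  Sig ∩ Φ , consistent-complement⇒IsType lem con′ sc proj₁ , con′ ,
  (λ p → Γ⊆Sig p , Γ⊆Φ p) , λ p → Δ⊆Sig p , λ (_ , q) → conΦΨ (shared⇒⊢ q (Δ⊆Ψ p))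
  where
  complement⊆Ψ : Sig ∖ (Sig ∩ Φ) ⊆ Ψ
  complement⊆Ψ {φ} (φ∈Sig , φ∉Sig∩Φ) =
    [ (λ φ∈Φ → ⊥-elim (φ∉Sig∩Φ (φ∈Sig , φ∈Φ))) , id ]′ (total φ)
  con′ : Consistent (Sig ∩ Φ) (Sig ∖ (Sig ∩ Φ))
  con′ = Consistent-antitone proj₂ complement⊆Ψ conΦΨ
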